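{- Let $L,R$ be nonempty subsets of a group $G$. In $2\mathrm{S}(G;L,R)$, if $g=w_{\bar{L},m,a}\,w_{\bar{R},n,b}$ for some $m,a,n,b\in\mathbb{N}$, then $g\sim l^d$ and $g\sim r^d$ for every $l\in L$ and every $r\in R$, where $d=m+n-(a+b)$.
   Context: For a group $G$ and nonempty subsets $L,R\subseteq G$, the two-sided group digraph $2\mathrm{S}(G;L,R)$ has vertex set $G$ and a directed arc $(g,h)$ if and only if $h=l^{ -1}gr$ for some $l\in L$, $r\in R$. We write $g\sim h$ ($g$ weakly connected to $h$) if there is a sequence $g=g_0,\dots,g_k=h$ such that for each $i$ either $(g_{i-1},g_i)$ or $(g_i,g_{i-1})$ is an arc. $w_{\bar{L},m,a}$ denotes a product in $G$ of $m+a$ factors, $m$ of which are elements of $L$ and $a$ of which are inverses of elements of $L$, in any order; similarly $w_{\bar{R},n,b}$ is a product of $n$ elements of $R$ and $b$ inverses of elements of $R$ in any order. Powers $l^d$ with $d\in\mathbb{Z}$ are group powers. -}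

module Defs where

open import Level using (Level; _⊔_)
open import Algebra.Bundles using (Group)
open import Data.Nat using (ℕ; zero; suc)
open import Data.Integer using (ℤ; +_; -[1+_])
open import Data.Bool using (Bool; true; false)
open import Data.Product using (Σ; _×_; _,_; ∃)
open import Data.List using (List; []; _∷_)
open import Data.List.Relation.Unary.All using (All)
open import Relation.Binary.PropositionalEquality using (_≡_)
open import Relation.Unary using (Pred; _∈_)

module TwoSided {c ℓ : Level} (G : Group c ℓ) where
  open Group G

  powℕ : Carrier → ℕ → Carrier
  powℕ x zero = ε
  powℕ x (suc n) = x ∙ powℕ x n

  pow : Carrier → ℤ → Carrier
  pow x (+ n) = powℕ x n
  pow x -[1+ n ] = (powℕ x (suc n)) ⁻¹

  Arc : {p : Level} → Pred Carrier p → Pred Carrier p → Carrier → Carrier → Set (c ⊔ ℓ ⊔ p)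
  Arc L R g h = Σ Carrier λ l → Σ Carrier λ r → l ∈ L × r ∈ R × (h ≈ (l ⁻¹ ∙ g) ∙ r)

  data WeakConn {p : Level} (L R : Pred Carrier p) : Carrier → Carrier → Set (c ⊔ ℓ ⊔ p) where
    stop : ∀ {g h} → g ≈ h → WeakConn L R g h
    fwd  : ∀ {g g' h} → Arc L R g g' → WeakConn L R g' h → WeakConn L R g h
    bwd  : ∀ {g g' h} → Arc L R g' g → WeakConn L R g' h → WeakConn L R g h

  -- a letter is (true , x) meaning x, or (false , x) meaning x ⁻¹
  letter : Bool × Carrier → Carrier
  letter (true , x) = x
  letter (false , x) = x ⁻¹

  evalWord : List (Bool × Carrier) → Carrier
  evalWord [] = ε
  evalWord (w ∷ ws) = letter w ∙ evalWord ws

  countPos : List (Bool × Carrier) → ℕ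
  countPos [] = zero
  countPos ((true , _) ∷ ws) = suc (countPos ws)
  countPos ((false , _) ∷ ws) = countPos ws

  countNeg : List (Bool × Carrier) → ℕ
  countNeg [] = zero
  countNeg ((true , _) ∷ ws) = countNeg ws
  countNeg ((false , _) ∷ ws) = suc (countNeg ws)

  -- IsWord S m a x : x is a product w_{S̄,m,a}, i.e. of m elements of S and
  -- a inverses of elements of S, in any order
  IsWord : {p : Level} → Pred Carrier p → ℕ → ℕ → Carrier → Set (c ⊔ ℓ ⊔ p)
  IsWord S m a x = Σ (List (Bool × Carrier)) λ ws →
    All (λ w → Data.Product.proj₂ w ∈ S) ws × countPos ws ≡ m × countNeg ws ≡ a × evalWord ws ≈ x

-- For l ∈ L, r ∈ R and any w the arc w ↦ l⁻¹ w r shows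
-- l^s w ∼ w r^s for a sign s = ±1: a letter of L may be traded for a
-- letter of R of the same sign on the opposite side.  Iterating over a
-- word gives the transfer lemma: if ws is a word over L and vs a word over
-- R with the same sign pattern, then ws·y ∼ y·vs.  Recolouring a word
-- (replacing every letter by one fixed element, keeping signs) produces
-- such matching pairs, and a word all of whose letters equal x evaluates
-- to the power x^e, e being its exponent sum.

module Submission where

open import Defs
open import Level using (Level)
open import Algebra.Bundles using (Group)
open import Data.Nat using (ℕ) renaming (_+_ to _+ℕ_)
open import Data.Integer using (+_; _-_)
open import Data.Product using (Σ; _×_; ∃)
open import Relation.Unary using (Pred; _∈_)

open import Data.Bool using (Bool; true; false)
open import Data.Product using (_,_; proj₁; proj₂)
open import Data.List using (List; []; _∷_; _++_; map)
open import Data.List.Relation.Unary.All using (All; []; _∷_)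
import Data.List.Relation.Unary.All.Properties as All
open import Data.List.Relation.Binary.Pointwise using (Pointwise; []; _∷_)
open import Relation.Binary.PropositionalEquality as P using (_≡_)
import Data.Integer as ℤ
import Data.Integer.Properties as ℤᵖ
open import Data.Integer.Tactic.RingSolver using (solve-∀)
import Algebra.Properties.Group as GroupProperties
import Relation.Binary.Reasoning.Setoid as SetoidReasoning

module Exponents where
  open ℤ using (ℤ; 1ℤ; -1ℤ; _+_)

  +1-step : ∀ p q → 1ℤ + (+ p - + q) ≡ + ℕ.suc p - + q
  +1-step p q = ring (+ p) (+ q)
    where
    ring : ∀ x y → 1ℤ + (x - y) ≡ (1ℤ + x) - y
    ring = solve-∀

  -1-step : ∀ p q → -1ℤ + (+ p - + q) ≡ + p - + ℕ.suc q
  -1-step p q = ring (+ p) (+ q)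
    where
    ring : ∀ x y → -1ℤ + (x - y) ≡ x - (1ℤ + y)
    ring = solve-∀

  concat-exponent : ∀ m a n b → (+ n - + b) + (+ m - + a) ≡ + (m +ℕ n) - + (a +ℕ b)
  concat-exponent m a n b = ring (+ m) (+ a) (+ n) (+ b)
    where
    ring : ∀ m a n b → (n - b) + (m - a) ≡ (m + n) - (a + b)
    ring = solve-∀

open Exponents

module Words {c ℓ : Level} (G : Group c ℓ) where
  open Group G hiding (_-_)
  open TwoSided G
  open GroupProperties G using (⁻¹-anti-homo-∙; \\-leftDividesˡ; \\-leftDividesʳ)
  open SetoidReasoning setoid
  open ℤ using (ℤ; 0ℤ; 1ℤ; -1ℤ; _+_)

  sign : Bool → ℤ
  sign true = 1ℤ
  sign false = -1ℤ

  expSum : List (Bool × Carrier) → ℤ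
  expSum [] = 0ℤ
  expSum ((s , _) ∷ ws) = sign s + expSum ws

  expSum-counts : ∀ ws → expSum ws ≡ + countPos ws - + countNeg ws
  expSum-counts [] = P.refl
  expSum-counts ((true , _) ∷ ws) =
    P.trans (P.cong (λ k → 1ℤ + k) (expSum-counts ws)) (+1-step (countPos ws) (countNeg ws))
  expSum-counts ((false , _) ∷ ws) =
    P.trans (P.cong (λ k → -1ℤ + k) (expSum-counts ws)) (-1-step (countPos ws) (countNeg ws))

  expSum-++ : ∀ xs ys → expSum (xs ++ ys) ≡ expSum xs + expSum ys
  expSum-++ [] ys = P.sym (ℤᵖ.+-identityˡ (expSum ys))
  expSum-++ ((s , _) ∷ xs) ys =
    P.trans (P.cong (λ k → sign s + k) (expSum-++ xs ys)) (P.sym (ℤᵖ.+-assoc (sign s) (expSum xs) (expSum ys)))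

  evalWord-++ : ∀ xs ys → evalWord (xs ++ ys) ≈ evalWord xs ∙ evalWord ys
  evalWord-++ [] ys = sym (identityˡ _)
  evalWord-++ (w ∷ xs) ys = trans (∙-congˡ (evalWord-++ xs ys)) (sym (assoc _ _ _))

  recolor : Carrier → List (Bool × Carrier) → List (Bool × Carrier)
  recolor x = map (λ w → proj₁ w , x)

  expSum-recolor : ∀ x ws → expSum (recolor x ws) ≡ expSum ws
  expSum-recolor x [] = P.refl
  expSum-recolor x ((s , _) ∷ ws) = P.cong (λ k → sign s + k) (expSum-recolor x ws)

  powℕ-comm : ∀ x n → x ∙ powℕ x n ≈ powℕ x n ∙ x
  powℕ-comm x ℕ.zero = trans (identityʳ x) (sym (identityˡ x))
  powℕ-comm x (ℕ.suc n) = begin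
    x ∙ (x ∙ powℕ x n)  ≈⟨ ∙-congˡ (powℕ-comm x n) ⟩
    x ∙ (powℕ x n ∙ x)  ≈⟨ assoc _ _ _ ⟨
    x ∙ powℕ x n ∙ x    ∎

  inverse-powℕ-suc : ∀ x n → (x ∙ powℕ x n) ⁻¹ ≈ x ⁻¹ ∙ powℕ x n ⁻¹
  inverse-powℕ-suc x n = begin
    (x ∙ powℕ x n) ⁻¹    ≈⟨ ⁻¹-cong (powℕ-comm x n) ⟩
    (powℕ x n ∙ x) ⁻¹    ≈⟨ ⁻¹-anti-homo-∙ (powℕ x n) x ⟩
    x ⁻¹ ∙ powℕ x n ⁻¹   ∎

  letter-pow : ∀ s x k → letter (s , x) ∙ pow x k ≈ pow x (sign s + k)
  letter-pow true x (+ n) = refl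
  letter-pow true x ℤ.-[1+ ℕ.zero ] = begin
    x ∙ (x ∙ ε) ⁻¹  ≈⟨ ∙-congˡ (⁻¹-cong (identityʳ x)) ⟩
    x ∙ x ⁻¹        ≈⟨ inverseʳ x ⟩
    ε               ∎
  letter-pow true x ℤ.-[1+ ℕ.suc n ] = begin
    x ∙ (x ∙ powℕ x (ℕ.suc n)) ⁻¹        ≈⟨ ∙-congˡ (inverse-powℕ-suc x (ℕ.suc n)) ⟩
    x ∙ (x ⁻¹ ∙ powℕ x (ℕ.suc n) ⁻¹)     ≈⟨ \\-leftDividesˡ x _ ⟩
    powℕ x (ℕ.suc n) ⁻¹                  ∎
  letter-pow false x (+ ℕ.zero) = trans (identityʳ _) (⁻¹-cong (sym (identityʳ x)))
  letter-pow false x (+ ℕ.suc n) = \\-leftDividesʳ x (powℕ x n)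
  letter-pow false x ℤ.-[1+ n ] = sym (inverse-powℕ-suc x (ℕ.suc n))

  evalWord-recolor : ∀ x ws → evalWord (recolor x ws) ≈ pow x (expSum ws)
  evalWord-recolor x [] = refl
  evalWord-recolor x ((s , _) ∷ ws) = begin
    letter (s , x) ∙ evalWord (recolor x ws)  ≈⟨ ∙-congˡ (evalWord-recolor x ws) ⟩
    letter (s , x) ∙ pow x (expSum ws)        ≈⟨ letter-pow s x (expSum ws) ⟩
    pow x (sign s + expSum ws)                ∎

module Connectivity {c ℓ p : Level} (G : Group c ℓ) (L R : Pred (Group.Carrier G) p) where
  open Group G hiding (_-_)
  open TwoSided G
  open Words G
  open GroupProperties G using (\\-leftDividesʳ; //-rightDividesˡ)
  open ℤ using (_+_)

  infix 4 _∼_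
  _∼_ : Carrier → Carrier → Set _
  _∼_ = WeakConn L R

  ∼-respˡ : ∀ {g₀ g h} → g₀ ≈ g → g ∼ h → g₀ ∼ h
  ∼-respˡ e (stop e') = stop (trans e e')
  ∼-respˡ e (fwd (l , r , l∈ , r∈ , h≈) w) =
    fwd (l , r , l∈ , r∈ , trans h≈ (∙-congʳ (∙-congˡ (sym e)))) w
  ∼-respˡ e (bwd (l , r , l∈ , r∈ , h≈) w) = bwd (l , r , l∈ , r∈ , trans e h≈) w

  ∼-trans : ∀ {g h k} → g ∼ h → h ∼ k → g ∼ k
  ∼-trans (stop e) w = ∼-respˡ e w
  ∼-trans (fwd a w) w' = fwd a (∼-trans w w')
  ∼-trans (bwd a w) w' = bwd a (∼-trans w w')

  ∼-sym : ∀ {g h} → g ∼ h → h ∼ g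
  ∼-sym (stop e) = stop (sym e)
  ∼-sym (fwd a w) = ∼-trans (∼-sym w) (bwd a (stop refl))
  ∼-sym (bwd a w) = ∼-trans (∼-sym w) (fwd a (stop refl))

  open import Relation.Binary.Reasoning.Base.Single _∼_ (stop refl) ∼-trans
    using (begin_; _∎; step-∼; step-≡-⟩)

  arc : ∀ {l r} → l ∈ L → r ∈ R → ∀ g → g ∼ l ⁻¹ ∙ g ∙ r
  arc {l} {r} l∈ r∈ g = fwd (l , r , l∈ , r∈ , refl) (stop refl)

  swap-letter : ∀ {l r} → l ∈ L → r ∈ R → ∀ s w → letter (s , l) ∙ w ∼ w ∙ letter (s , r)
  swap-letter {l} {r} l∈ r∈ true w = begin
    l ∙ w                ∼⟨ arc l∈ r∈ (l ∙ w) ⟩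
    l ⁻¹ ∙ (l ∙ w) ∙ r   ∼⟨ stop (∙-congʳ (\\-leftDividesʳ l w)) ⟩
    w ∙ r                ∎
  swap-letter {l} {r} l∈ r∈ false w = begin
    l ⁻¹ ∙ w                   ∼⟨ stop (sym (∙-congˡ (//-rightDividesˡ r w))) ⟩
    l ⁻¹ ∙ (w ∙ r ⁻¹ ∙ r)      ∼⟨ stop (sym (assoc _ _ _)) ⟩
    l ⁻¹ ∙ (w ∙ r ⁻¹) ∙ r      ∼⟨ ∼-sym (arc l∈ r∈ (w ∙ r ⁻¹)) ⟩
    w ∙ r ⁻¹                   ∎

  Matched : Bool × Carrier → Bool × Carrier → Set p
  Matched (s , x) (t , z) = s ≡ t × x ∈ L × z ∈ R

  transfer : ∀ {ws vs} → Pointwise Matched ws vs → ∀ y → evalWord ws ∙ y ∼ y ∙ evalWord vs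
  transfer [] y = stop (trans (identityˡ y) (sym (identityʳ y)))
  transfer {(s , x) ∷ ws} {(.s , z) ∷ vs} ((P.refl , x∈ , z∈) ∷ matched) y = begin
    letter (s , x) ∙ evalWord ws ∙ y      ∼⟨ stop (assoc _ _ _) ⟩
    letter (s , x) ∙ (evalWord ws ∙ y)    ∼⟨ swap-letter x∈ z∈ s (evalWord ws ∙ y) ⟩
    evalWord ws ∙ y ∙ letter (s , z)      ∼⟨ stop (assoc _ _ _) ⟩
    evalWord ws ∙ (y ∙ letter (s , z))    ∼⟨ transfer matched (y ∙ letter (s , z)) ⟩
    y ∙ letter (s , z) ∙ evalWord vs      ∼⟨ stop (assoc _ _ _) ⟩
    y ∙ (letter (s , z) ∙ evalWord vs)    ∎

  matched-recolorʳ : ∀ {r} → r ∈ R → ∀ {ws} → All (λ w → proj₂ w ∈ L) ws → Pointwise Matched ws (recolor r ws)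
  matched-recolorʳ r∈ [] = []
  matched-recolorʳ r∈ (x∈ ∷ all) = (P.refl , x∈ , r∈) ∷ matched-recolorʳ r∈ all

  matched-recolorˡ : ∀ {l} → l ∈ L → ∀ {vs} → All (λ w → proj₂ w ∈ R) vs → Pointwise Matched (recolor l vs) vs
  matched-recolorˡ l∈ [] = []
  matched-recolorˡ l∈ (z∈ ∷ all) = (P.refl , l∈ , z∈) ∷ matched-recolorˡ l∈ all

  recolor-All : ∀ {S : Pred Carrier p} {x} → x ∈ S → ∀ ws → All (λ w → proj₂ w ∈ S) (recolor x ws)
  recolor-All x∈ [] = []
  recolor-All x∈ (w ∷ ws) = x∈ ∷ recolor-All x∈ ws

  product∼powʳ : ∀ {l₀ r} → l₀ ∈ L → r ∈ R → ∀ {ws vs} →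
    All (λ w → proj₂ w ∈ L) ws → All (λ w → proj₂ w ∈ R) vs →
    evalWord ws ∙ evalWord vs ∼ pow r (expSum vs + expSum ws)
  product∼powʳ {l₀} {r} l₀∈ r∈ {ws} {vs} allL allR = begin
    evalWord ws ∙ evalWord vs                 ∼⟨ ∼-sym (transfer (matched-recolorˡ l₀∈ allR) (evalWord ws)) ⟩
    evalWord (recolor l₀ vs) ∙ evalWord ws    ∼⟨ stop (sym (evalWord-++ (recolor l₀ vs) ws)) ⟩
    evalWord X                                ∼⟨ stop (sym (identityʳ _)) ⟩
    evalWord X ∙ ε                            ∼⟨ transfer (matched-recolorʳ r∈ allX) ε ⟩
    ε ∙ evalWord (recolor r X)                ∼⟨ stop (identityˡ _) ⟩
    evalWord (recolor r X)                    ∼⟨ stop (evalWord-recolor r X) ⟩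
    pow r (expSum X)                          ≡⟨ P.cong (pow r) expSum-X ⟩
    pow r (expSum vs + expSum ws)             ∎
    where
    X = recolor l₀ vs ++ ws
    allX : All (λ w → proj₂ w ∈ L) X
    allX = All.++⁺ (recolor-All l₀∈ vs) allL
    expSum-X : expSum X ≡ expSum vs + expSum ws
    expSum-X = P.trans (expSum-++ (recolor l₀ vs) ws) (P.cong (_+ expSum ws) (expSum-recolor l₀ vs))

  product∼powˡ : ∀ {l r₀} → l ∈ L → r₀ ∈ R → ∀ {ws vs} →
    All (λ w → proj₂ w ∈ L) ws → All (λ w → proj₂ w ∈ R) vs →
    evalWord ws ∙ evalWord vs ∼ pow l (expSum vs + expSum ws)
  product∼powˡ {l} {r₀} l∈ r₀∈ {ws} {vs} allL allR = begin
    evalWord ws ∙ evalWord vs                 ∼⟨ transfer (matched-recolorʳ r₀∈ allL) (evalWord vs) ⟩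
    evalWord vs ∙ evalWord (recolor r₀ ws)    ∼⟨ stop (sym (evalWord-++ vs (recolor r₀ ws))) ⟩
    evalWord Y                                ∼⟨ stop (sym (identityˡ _)) ⟩
    ε ∙ evalWord Y                            ∼⟨ ∼-sym (transfer (matched-recolorˡ l∈ allY) ε) ⟩
    evalWord (recolor l Y) ∙ ε                ∼⟨ stop (identityʳ _) ⟩
    evalWord (recolor l Y)                    ∼⟨ stop (evalWord-recolor l Y) ⟩
    pow l (expSum Y)                          ≡⟨ P.cong (pow l) expSum-Y ⟩
    pow l (expSum vs + expSum ws)             ∎
    where
    Y = vs ++ recolor r₀ ws
    allY : All (λ w → proj₂ w ∈ R) Y
    allY = All.++⁺ allR (recolor-All r₀∈ ws)
    expSum-Y : expSum Y ≡ expSum vs + expSum ws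
    expSum-Y = P.trans (expSum-++ vs (recolor r₀ ws)) (P.cong (λ k → expSum vs + k) (expSum-recolor r₀ ws))

open Group using (Carrier; _≈_; _∙_)
open TwoSided using (IsWord; WeakConn; pow)

lemma3p2 : {c ℓ p : Level} (G : Group c ℓ) →
    (L R : Pred (Carrier G) p) → ∃ (λ l → l ∈ L) → ∃ (λ r → r ∈ R) →
    (g : Carrier G) (m a n b : ℕ) →
    (Σ (Carrier G) λ u → Σ (Carrier G) λ v →
    IsWord G L m a u × IsWord G R n b v × _≈_ G g (_∙_ G u v)) →
    ((l : Carrier G) → l ∈ L →
    WeakConn G L R g (pow G l ((+ (m +ℕ n)) - (+ (a +ℕ b))))) ×
    ((r : Carrier G) → r ∈ R →
    WeakConn G L R g (pow G r ((+ (m +ℕ n)) - (+ (a +ℕ b)))))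
lemma3p2 G L R (l₀ , l₀∈) (r₀ , r₀∈) g m a n b
  (u , v , (ws , allL , P.refl , P.refl , ws≈u) , (vs , allR , P.refl , P.refl , vs≈v) , g≈uv) =
  (λ l l∈ → toPower (pow G l) (product∼powˡ l∈ r₀∈ allL allR)) ,
  (λ r r∈ → toPower (pow G r) (product∼powʳ l₀∈ r∈ allL allR))
  where
  open Group G using (trans; sym; ∙-cong)
  open TwoSided G using (evalWord)
  open Words G using (expSum; expSum-counts)
  open Connectivity G L R using (_∼_; ∼-respˡ; product∼powˡ; product∼powʳ)

  exponent : expSum vs ℤ.+ expSum ws ≡ + (m +ℕ n) - + (a +ℕ b)
  exponent = P.trans (P.cong₂ ℤ._+_ (expSum-counts vs) (expSum-counts ws)) (concat-exponent m a n b)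

  g≈words : _≈_ G g (_∙_ G (evalWord ws) (evalWord vs))
  g≈words = trans g≈uv (∙-cong (sym ws≈u) (sym vs≈v))

  toPower : (power : ℤ.ℤ → Carrier G) →
    _∙_ G (evalWord ws) (evalWord vs) ∼ power (expSum vs ℤ.+ expSum ws) →
    g ∼ power (+ (m +ℕ n) - + (a +ℕ b))
  toPower power conn = ∼-respˡ g≈words (P.subst (λ e → _∙_ G (evalWord ws) (evalWord vs) ∼ power e) exponent conn)
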